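{- Let $\mathcal{A}$ be a finite set, $p\ge2$ an integer, $i\in[p]$, $\tau\in(0,1)$, $A\subseteq\mathcal{A}^p$ a $\tau$-thick set, and $S\subseteq\mathcal{A}$. Then $A^{i,S}_{\neq i}$ is $\tau$-thick, and $A^{i,S}_{\neq i}$ is empty if and only if $S\cap A_i$ is empty.
   Context: For $a\in\mathcal{A}^p$, $a_{\neq i}\in\mathcal{A}^{p-1}$ is $a$ with the $i$-th coordinate removed; $A_{\neq i}=\{a_{\neq i}:a\in A\}$ and $A_i=\{a_i:a\in A\}$. For $a'\in\mathcal{A}^{p-1}$, $\mathrm{Ext}^i_A(a')=\{x\in\mathcal{A}: \text{the tuple obtained by inserting } x \text{ at position } i \text{ of } a' \text{ lies in } A\}$. For $p\ge2$, $d_{\min}(A,i)=\min_{a'\in A_{\neq i}}|\mathrm{Ext}^i_A(a')|$, and $A$ is $\tau$-thick if $d_{\min}(A,i)\ge\tau|\mathcal{A}|$ for all $i\in[p]$ (so the empty set is $\tau$-thick). For $p=1$, a set $A\subseteq\mathcal{A}$ is $\tau$-thick if $|A|\ge\tau|\mathcal{A}|$; by convention the empty set is also regarded as $\tau$-thick. For $S\subseteq\mathcal{A}$, $A^{i,S}=\{a\in A:a_i\in S\}$ and $A^{i,S}_{\neq i}=(A^{i,S})_{\neq i}\subseteq\mathcal{A}^{p-1}$.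
   Formalization: The parameter τ in (0,1) takes rational values only. -}

module Defs where

open import Data.Bool using (Bool; true; false; _∧_; T)
open import Data.Nat using (ℕ; zero; suc)
open import Data.Fin using (Fin) renaming (_≟_ to _≟ᶠ_)
open import Data.Fin.Subset using (Subset; ∣_∣)
open import Data.List using (List; []; _∷_; map; concatMap; filter; length; allFin)
open import Data.Bool.ListAction using (any)
open import Data.Vec using (Vec; []; _∷_; lookup; insertAt; removeAt; tabulate)
open import Data.Vec.Properties using (≡-dec)
open import Data.Integer using (+_)
open import Data.Rational using (ℚ; _/_; _*_; _≤_)
open import Relation.Nullary.Decidable using (⌊_⌋; does)
open import Relation.Binary.PropositionalEquality using (_≡_)
open import Data.Sum using (_⊎_)

-- The finite alphabet 𝒜 is Fin m.  A subset of 𝒜^p is given by its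
-- (Bool-valued) characteristic function on Vec (Fin m) p.
FSet : ℕ → ℕ → Set
FSet m p = Vec (Fin m) p → Bool

allVecs : ∀ m p → List (Vec (Fin m) p)
allVecs m zero = [] ∷ []
allVecs m (suc p) = concatMap (λ x → map (x ∷_) (allVecs m p)) (allFin m)

card : ∀ {m p} → FSet m p → ℕ
card {m} {p} A = length (filter (λ a → T? (A a)) (allVecs m p))
  where
  open import Data.Bool using (T?)

IsEmpty : ∀ {m p} → FSet m p → Set
IsEmpty {m} {p} A = (a : Vec (Fin m) p) → A a ≡ false

proj : ∀ {m p} → FSet m (suc p) → Fin (suc p) → FSet m p
proj {m} {p} A i a' =
  any (λ a → A a ∧ does (≡-dec _≟ᶠ_ (removeAt a i) a')) (allVecs m (suc p))

coord : ∀ {m p} → FSet m p → Fin p → Subset m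
coord {m} {p} A i =
  tabulate (λ x → any (λ a → A a ∧ does (lookup a i ≟ᶠ x)) (allVecs m p))

restrict : ∀ {m p} → FSet m p → Fin p → Subset m → FSet m p
restrict A i S a = A a ∧ lookup S (lookup a i)

Ext : ∀ {m p} → FSet m (suc p) → Fin (suc p) → Vec (Fin m) p → Subset m
Ext A i a' = tabulate (λ x → A (insertAt a' i x))

ℕtoℚ : ℕ → ℚ
ℕtoℚ n = (+ n) / 1

-- τ-thickness of A ⊆ 𝒜^(suc p).
-- p+1 = 1 : |A| ≥ τ|𝒜| or A = ∅.
-- p+1 ≥ 2 : d_min(A,i) ≥ τ|𝒜| for all i, i.e. every a' ∈ A_{≠i} has
--           |Ext^i_A(a')| ≥ τ|𝒜| (vacuous when A is empty).
Thick : ∀ {m} p → ℚ → FSet m (suc p) → Set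
Thick {m} zero τ A = IsEmpty A ⊎ (τ * ℕtoℚ m ≤ ℕtoℚ (card A))
Thick {m} (suc p) τ A =
  (i : Fin (suc (suc p))) (a' : Vec (Fin m) (suc p)) →
  T (proj A i a') → τ * ℕtoℚ m ≤ ℕtoℚ ∣ Ext A i a' ∣

DisjointS : ∀ {m} → Subset m → Subset m → Set
DisjointS {m} S B = (x : Fin m) → (lookup S x ∧ lookup B x) ≡ false

module Submission where

-- Thickness is first recast as a statement about lines: B is τ-thick iff
-- every axis-parallel line through a point of B meets B in at least τ|𝒜|
-- points (`thick⇔linesThick`, valid in every dimension, including the
-- degenerate one-dimensional convention).  For a point b = a_{≠i} of B,
-- the line of B through b in direction j contains the image of the line
-- of A through a in direction punchIn i j (`line-inclusion`): moving a
-- along a coordinate other than i keeps a_i ∈ S.  Hence lines of B are at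
-- least as long as lines of A, and thickness passes from A to B.
-- The emptiness criterion holds because B has a point iff some a ∈ A has
-- a_i ∈ S, iff S ∩ A_i has a point.

open import Defs
open import Data.Nat using (ℕ; suc)
open import Data.Fin using (Fin)
open import Data.Fin.Subset using (Subset)
open import Data.Rational using (ℚ; 0ℚ; 1ℚ; _<_)
open import Data.Product using (_×_)
open import Function.Bundles using (_⇔_)

open import Data.Nat as ℕ using (zero)
open import Data.Fin as F using (punchIn) renaming (_≟_ to _≟ᶠ_)
open import Data.Fin.Properties using (punchInᵢ≢i)
open import Data.Fin.Subset using (∣_∣; _⊆_)
open import Data.Fin.Subset.Properties using (p⊆q⇒∣p∣≤∣q∣)
open import Data.Bool using (Bool; true; false; _∧_; T; T?)
open import Data.Bool.Properties using (T-∧; T-≡)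
open import Data.Bool.ListAction using (any)
import Data.List as L
import Data.List.Properties as LP
open import Data.List.Membership.Propositional using (_∈_; lose)
open import Data.List.Membership.Propositional.Properties
  using (∈-allFin; ∈-map⁺; ∈-concatMap⁺)
open import Data.List.Relation.Unary.Any using (here; satisfied)
open import Data.List.Relation.Unary.Any.Properties using (any⁺; any⁻)
open import Data.Vec using (Vec; []; _∷_; lookup; insertAt; removeAt; tabulate; _[_]≔_)
open import Data.Vec.Properties
  using (≡-dec; lookup∘tabulate; lookup∘updateAt′; []=⇒lookup; lookup⇒[]=)
open import Data.Integer as ℤ using (+_)
import Data.Integer.Properties as ℤP
open import Data.Rational using (mkℚ; *≤*; _*_; _≤_)
import Data.Rational.Properties as QP
import Data.Nat.Coprimality as Coprime
open import Data.Unit using (tt)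
open import Data.Empty using (⊥-elim)
open import Data.Product using (∃; _,_)
open import Data.Sum using (_⊎_; inj₁; inj₂)
open import Function using (_∘_)
open import Function.Bundles using (mk⇔; Equivalence)
import Function.Properties.Equivalence as ⇔
open import Relation.Nullary using (¬_; Dec; yes; no; does; contraposition)
open import Relation.Binary.PropositionalEquality
open ≡-Reasoning

open Equivalence using (to; from)

T-does : ∀ {P : Set} (d : Dec P) → T (does d) ⇔ P
T-does (yes p) = mk⇔ (λ _ → p) (λ _ → tt)
T-does (no ¬p) = mk⇔ (λ ()) ¬p

allFalse⇔noWitness : ∀ {X : Set} (f : X → Bool) →
  (∀ x → f x ≡ false) ⇔ (¬ ∃ λ x → T (f x))
allFalse⇔noWitness f = mk⇔
  (λ allFalse (x , t) → subst T (allFalse x) t)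
  (λ none x → ¬T⇒false (λ t → none (x , t)))
  where
  ¬T⇒false : ∀ {b} → ¬ T b → b ≡ false
  ¬T⇒false {false} _ = refl
  ¬T⇒false {true} ¬t = ⊥-elim (¬t tt)

¬-cong : ∀ {P Q : Set} → P ⇔ Q → (¬ P) ⇔ (¬ Q)
¬-cong P⇔Q = mk⇔ (contraposition (from P⇔Q)) (contraposition (to P⇔Q))

T-lookup-tabulate : ∀ {m} (f : Fin m → Bool) (x : Fin m) →
  T (lookup (tabulate f) x) ⇔ T (f x)
T-lookup-tabulate f x =
  mk⇔ (subst T (lookup∘tabulate f x)) (subst T (sym (lookup∘tabulate f x)))

⊆-byEntries : ∀ {m} {p q : Subset m} →
  (∀ x → T (lookup p x) → T (lookup q x)) → p ⊆ q
⊆-byEntries p⇒q {x} x∈p =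
  lookup⇒[]= x _ (to T-≡ (p⇒q x (from T-≡ ([]=⇒lookup x∈p))))

∈-allVecs : ∀ {m p} (v : Vec (Fin m) p) → v ∈ allVecs m p
∈-allVecs [] = here refl
∈-allVecs {m} {suc p} (x ∷ v) =
  ∈-concatMap⁺ (λ y → L.map (y ∷_) (allVecs m p))
    (lose (∈-allFin x) (∈-map⁺ (x ∷_) (∈-allVecs v)))

any-allVecs⇔ : ∀ {m p} (f : FSet m p) →
  T (any f (allVecs m p)) ⇔ (∃ λ v → T (f v))
any-allVecs⇔ {m} {p} f = mk⇔
  (λ t → satisfied (any⁻ f (allVecs m p) t))
  (λ (v , t) → any⁺ f (lose (∈-allVecs v) t))

empty-or-inhabited : ∀ {m p} (B : FSet m p) → IsEmpty B ⊎ (∃ λ b → T (B b))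
empty-or-inhabited B with T? (any B (allVecs _ _))
... | yes t = inj₂ (to (any-allVecs⇔ B) t)
... | no ¬t = inj₁ (from (allFalse⇔noWitness B) (contraposition (from (any-allVecs⇔ B)) ¬t))

proj⇔ : ∀ {m p} (A : FSet m (suc p)) (k : Fin (suc p)) (a' : Vec (Fin m) p) →
  T (proj A k a') ⇔ (∃ λ a → T (A a) × removeAt a k ≡ a')
proj⇔ A k a' = mk⇔
  (λ t → let (a , t′) = to (any-allVecs⇔ _) t
             (Aa , same) = to T-∧ t′
         in a , Aa , to (T-does (≡-dec _≟ᶠ_ _ _)) same)
  (λ (a , Aa , eq) →
     from (any-allVecs⇔ _) (a , from T-∧ (Aa , from (T-does (≡-dec _≟ᶠ_ _ _)) eq)))

coord⇔ : ∀ {m p} (A : FSet m p) (k : Fin p) (x : Fin m) →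
  T (lookup (coord A k) x) ⇔ (∃ λ a → T (A a) × lookup a k ≡ x)
coord⇔ A k x = ⇔.trans (T-lookup-tabulate _ x) (mk⇔
  (λ t → let (a , t′) = to (any-allVecs⇔ _) t
             (Aa , same) = to T-∧ t′
         in a , Aa , to (T-does (lookup a k ≟ᶠ x)) same)
  (λ (a , Aa , eq) →
     from (any-allVecs⇔ _) (a , from T-∧ (Aa , from (T-does (lookup a k ≟ᶠ x)) eq))))

insertAt-removeAt-≔ : ∀ {X : Set} {n} (a : Vec X (suc n)) (k : Fin (suc n)) (x : X) →
  insertAt (removeAt a k) k x ≡ a [ k ]≔ x
insertAt-removeAt-≔ (y ∷ a) F.zero x = refl
insertAt-removeAt-≔ (y ∷ z ∷ a) (F.suc k) x = cong (y ∷_) (insertAt-removeAt-≔ (z ∷ a) k x)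

Ext-line⇔ : ∀ {m p} (A : FSet m (suc p)) (a : Vec (Fin m) (suc p)) (k : Fin (suc p)) (x : Fin m) →
  T (lookup (Ext A k (removeAt a k)) x) ⇔ T (A (a [ k ]≔ x))
Ext-line⇔ A a k x = ⇔.trans (T-lookup-tabulate _ x)
  (mk⇔ (subst (T ∘ A) (insertAt-removeAt-≔ a k x))
       (subst (T ∘ A) (sym (insertAt-removeAt-≔ a k x))))

-- removeAt computes on a cons even when the tail is not in constructor form.
removeAt-suc : ∀ {X : Set} {n} (y : X) (v : Vec X (suc n)) (i : Fin (suc n)) →
  removeAt (y ∷ v) (F.suc i) ≡ y ∷ removeAt v i
removeAt-suc y (z ∷ v) i = refl

removeAt-≔-punchIn : ∀ {X : Set} {n} (a : Vec X (suc (suc n)))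
  (i : Fin (suc (suc n))) (j : Fin (suc n)) (x : X) →
  removeAt (a [ punchIn i j ]≔ x) i ≡ removeAt a i [ j ]≔ x
removeAt-≔-punchIn (y ∷ a) F.zero j x = refl
removeAt-≔-punchIn (y ∷ z ∷ a) (F.suc i) F.zero x = refl
removeAt-≔-punchIn {n = suc n} (y ∷ z ∷ a) (F.suc i) (F.suc j) x = begin
  removeAt (y ∷ (z ∷ a) [ punchIn i j ]≔ x) (F.suc i) ≡⟨ removeAt-suc y ((z ∷ a) [ punchIn i j ]≔ x) i ⟩
  y ∷ removeAt ((z ∷ a) [ punchIn i j ]≔ x) i         ≡⟨ cong (y ∷_) (removeAt-≔-punchIn (z ∷ a) i j x) ⟩
  y ∷ removeAt (z ∷ a) i [ j ]≔ x                      ∎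

lookup-≔-punchIn : ∀ {X : Set} {n} (a : Vec X (suc n)) (i : Fin (suc n)) (j : Fin n) (x : X) →
  lookup (a [ punchIn i j ]≔ x) i ≡ lookup a i
lookup-≔-punchIn a i j x = lookup∘updateAt′ i (punchIn i j) (punchInᵢ≢i i j ∘ sym) a

∣tabulate∣ : ∀ {X : Set} m (h : Fin m → X) (P : X → Bool) →
  ∣ tabulate (P ∘ h) ∣ ≡ L.length (L.filter (T? ∘ P) (L.tabulate h))
∣tabulate∣ zero h P = refl
∣tabulate∣ (suc m) h P with P (h F.zero)
... | true = cong suc (∣tabulate∣ m (h ∘ F.suc) P)
... | false = ∣tabulate∣ m (h ∘ F.suc) P

allVecs-1 : ∀ m → allVecs m 1 ≡ L.tabulate (λ x → x ∷ [])
allVecs-1 m = begin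
  L.concatMap (L.[_] ∘ single) (L.allFin m) ≡⟨ LP.concatMap-map L.[_] single (L.allFin m) ⟨
  L.concatMap L.[_] (L.map single (L.allFin m)) ≡⟨ LP.concatMap-pure _ ⟩
  L.map single (L.allFin m)                     ≡⟨ LP.map-tabulate (λ x → x) single ⟩
  L.tabulate single                             ∎
  where
  single : Fin m → Vec (Fin m) 1
  single x = x ∷ []

∣line∣≡card : ∀ {m} (B : FSet m 1) (v : Vec (Fin m) 0) → ∣ Ext B F.zero v ∣ ≡ card B
∣line∣≡card {m} B [] = begin
  ∣ tabulate (λ x → B (x ∷ [])) ∣                          ≡⟨ ∣tabulate∣ m (λ x → x ∷ []) B ⟩
  L.length (L.filter (T? ∘ B) (L.tabulate (λ x → x ∷ []))) ≡⟨ cong (L.length ∘ L.filter (T? ∘ B)) (allVecs-1 m) ⟨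
  card B                                                   ∎

ℕtoℚ-mono : ∀ {a b} → a ℕ.≤ b → ℕtoℚ a ≤ ℕtoℚ b
ℕtoℚ-mono {a} {b} a≤b = subst₂ _≤_ (sym (ℕtoℚ≡ a)) (sym (ℕtoℚ≡ b))
  (*≤* (subst₂ ℤ._≤_ (sym (ℤP.*-identityʳ (+ a))) (sym (ℤP.*-identityʳ (+ b))) (ℤ.+≤+ a≤b)))
  where
  ℕtoℚ≡ : ∀ n → ℕtoℚ n ≡ mkℚ (+ n) 0 (Coprime.sym (Coprime.1-coprimeTo n))
  ℕtoℚ≡ n = QP.normalize-coprime (Coprime.sym (Coprime.1-coprimeTo n))

LinesThick : ∀ {m p} → ℚ → FSet m (suc p) → Set
LinesThick {m} τ B =
  ∀ b → T (B b) → ∀ j → τ * ℕtoℚ m ≤ ℕtoℚ ∣ Ext B j (removeAt b j) ∣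

thick⇔linesThick : ∀ {m} p (τ : ℚ) (B : FSet m (suc p)) → Thick p τ B ⇔ LinesThick τ B
thick⇔linesThick {m} zero τ B = mk⇔ toLines fromLines
  where
  toLines : Thick zero τ B → LinesThick τ B
  toLines (inj₁ empty) b Bb j = ⊥-elim (subst T (empty b) Bb)
  toLines (inj₂ large) (x ∷ []) Bb F.zero =
    subst (λ k → τ * ℕtoℚ m ≤ ℕtoℚ k) (sym (∣line∣≡card B [])) large
  fromLines : LinesThick τ B → Thick zero τ B
  fromLines lines with empty-or-inhabited B
  ... | inj₁ empty = inj₁ empty
  ... | inj₂ ((x ∷ []) , Bb) =
    inj₂ (subst (λ k → τ * ℕtoℚ m ≤ ℕtoℚ k) (∣line∣≡card B []) (lines (x ∷ []) Bb F.zero))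
thick⇔linesThick {m} (suc p) τ B = mk⇔
  (λ thick b Bb j → thick j (removeAt b j) (from (proj⇔ B j _) (b , Bb , refl)))
  (λ lines j b′ t → let (b , Bb , eq) = to (proj⇔ B j b′) t in
     subst (λ c → τ * ℕtoℚ m ≤ ℕtoℚ ∣ Ext B j c ∣) eq (lines b Bb j))

module _ {m n} (A : FSet m (suc (suc n))) (i : Fin (suc (suc n))) (S : Subset m) where

  private
    B : FSet m (suc n)
    B = proj (restrict A i S) i

  line-inclusion : ∀ a → T (A a) → T (lookup S (lookup a i)) → (j : Fin (suc n)) →
    Ext A (punchIn i j) (removeAt a (punchIn i j)) ⊆ Ext B j (removeAt (removeAt a i) j)
  line-inclusion a Aa Sa j = ⊆-byEntries λ x onLineA →
    let a′ = a [ punchIn i j ]≔ x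
        Sa′ = subst (T ∘ lookup S) (sym (lookup-≔-punchIn a i j x)) Sa
    in from (Ext-line⇔ B (removeAt a i) j x)
         (from (proj⇔ (restrict A i S) i _)
           (a′ , from T-∧ (to (Ext-line⇔ A a (punchIn i j) x) onLineA , Sa′) ,
            removeAt-≔-punchIn a i j x))

  restriction-linesThick : ∀ τ → LinesThick τ A → LinesThick τ B
  restriction-linesThick τ linesA b Bb j with to (proj⇔ (restrict A i S) i b) Bb
  ... | a , aInRestriction , refl =
    let (Aa , Sa) = to T-∧ aInRestriction
    in QP.≤-trans (linesA a Aa (punchIn i j))
         (ℕtoℚ-mono (p⊆q⇒∣p∣≤∣q∣ (line-inclusion a Aa Sa j)))

  restriction-inhabited⇔ :
    (∃ λ b → T (B b)) ⇔ (∃ λ x → T (lookup S x ∧ lookup (coord A i) x))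
  restriction-inhabited⇔ = mk⇔
    (λ (b , Bb) →
      let (a , aInRestriction , _) = to (proj⇔ (restrict A i S) i b) Bb
          (Aa , Sa) = to T-∧ aInRestriction
      in lookup a i , from T-∧ (Sa , from (coord⇔ A i _) (a , Aa , refl)))
    (λ (x , t) →
      let (Sx , inAi) = to T-∧ t
          (a , Aa , aᵢ≡x) = to (coord⇔ A i x) inAi
          Sa = subst (T ∘ lookup S) (sym aᵢ≡x) Sx
      in removeAt a i , from (proj⇔ (restrict A i S) i _) (a , from T-∧ (Aa , Sa) , refl))

  restriction-empty⇔ : IsEmpty B ⇔ DisjointS S (coord A i)
  restriction-empty⇔ =
    ⇔.trans (allFalse⇔noWitness B)
      (⇔.trans (¬-cong restriction-inhabited⇔) (⇔.sym (allFalse⇔noWitness _)))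

lemma2 : (m n : ℕ) (i : Fin (suc (suc n))) (τ : ℚ) → 0ℚ < τ → τ < 1ℚ →
    (A : FSet m (suc (suc n))) → Thick (suc n) τ A → (S : Subset m) →
    Thick n τ (proj (restrict A i S) i)
    × (IsEmpty (proj (restrict A i S) i) ⇔ DisjointS S (coord A i))
lemma2 m n i τ _ _ A thickA S =
  from (thick⇔linesThick n τ (proj (restrict A i S) i))
       (restriction-linesThick A i S τ (to (thick⇔linesThick (suc n) τ A) thickA))
  , restriction-empty⇔ A i S
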